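{- Let $\mathcal{H}$ be a 3-uniform hypergraph containing no copy of $\mathcal{M}$ and let $\mathcal{H}'$ be its 13-core. Let $Z$ be the set of vertices $z \in V(\mathcal{H}')$ with $\tau(Tr_{\mathcal{H}'}(z)) = 1$, let $Y$ be the set of vertices $y$ that are the center of the star $Tr_{\mathcal{H}'}(z)$ for some $z \in Z$, and let $X = V(\mathcal{H}') \setminus (Y \cup Z)$. Then $\mathcal{H}'[X \cup Y]$ is a partial Steiner triple system.
   Context: The messy path $\mathcal{M}$ is $\{abc, bcd, def\}$ on six distinct vertices. The 13-core is obtained by iteratively deleting vertices of degree less than 13 (with their triples) until all remaining vertices have degree at least 13. $Tr_{\mathcal{H}'}(v) = \{ e \setminus \{v\} : e \in \mathcal{H}', v \in e\}$ is the trace graph of $v$; $\tau$ is the vertex cover number. $\mathcal{H}'[U]$ is the set of triples of $\mathcal{H}'$ contained in $U$. A partial Steiner triple system is a 3-uniform hypergraph in which every pair of vertices lies in at most one triple. -}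

module Defs where

open import Data.Nat using (ℕ; zero; suc; _+_; _<_; _≤_; _<ᵇ_)
open import Data.Fin using (Fin; zero; suc; toℕ; _≟_)
open import Data.Bool using (Bool; true; false; if_then_else_; _∧_)
open import Data.Product using (_×_; Σ; ∃; ∃-syntax)
open import Data.Sum using (_⊎_)
open import Relation.Nullary using (¬_; does)
open import Relation.Binary.PropositionalEquality using (_≡_; _≢_)
open import Relation.Binary.Construct.Closure.ReflexiveTransitive using (Star)

-- A finite 3-uniform hypergraph on vertex set Fin n: edge a b c = true iff
-- {a,b,c} is a triple of the hypergraph (symmetric, only distinct vertices).
record Hypergraph (n : ℕ) : Set where
  field
    edge     : Fin n → Fin n → Fin n → Bool
    sym₁     : ∀ a b c → edge a b c ≡ edge b a c
    sym₂     : ∀ a b c → edge a b c ≡ edge a c b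
    distinct : ∀ a b c → edge a b c ≡ true → a ≢ b × b ≢ c × a ≢ c
open Hypergraph public

countB : ∀ {n} → (Fin n → Bool) → ℕ
countB {zero}  f = 0
countB {suc n} f = (if f zero then 1 else 0) + countB (λ i → f (suc i))

sumF : ∀ {n} → (Fin n → ℕ) → ℕ
sumF {zero}  f = 0
sumF {suc n} f = f zero + sumF (λ i → f (suc i))

VSet : ℕ → Set
VSet n = Fin n → Bool

-- degree of v in the induced subhypergraph H[S] (number of triples of H
-- contained in S that contain v); each triple {v,a,b} counted once (a < b)
deg : ∀ {n} → Hypergraph n → VSet n → Fin n → ℕ
deg H S v = sumF (λ a → countB (λ b →
  (toℕ a <ᵇ toℕ b) ∧ S v ∧ S a ∧ S b ∧ edge H v a b))

remove : ∀ {n} → VSet n → Fin n → VSet n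
remove S v w = if does (w ≟ v) then false else S w

data PeelStep {n : ℕ} (k : ℕ) (H : Hypergraph n) : VSet n → VSet n → Set where
  del : ∀ S v → S v ≡ true → deg H S v < k → PeelStep k H S (remove S v)

IsCore : ∀ {n} → ℕ → Hypergraph n → VSet n → Set
IsCore {n} k H U =
  Star (PeelStep k H) (λ _ → true) U × (∀ v → U v ≡ true → k ≤ deg H U v)

-- H contains a copy of the messy path {abc, bcd, def} on six distinct vertices
ContainsM : ∀ {n} → Hypergraph n → Set
ContainsM {n} H = Σ (Fin n) λ a → Σ (Fin n) λ b → Σ (Fin n) λ c →
  Σ (Fin n) λ d → Σ (Fin n) λ e → Σ (Fin n) λ f →
  (a ≢ b × a ≢ c × a ≢ d × a ≢ e × a ≢ f × b ≢ c × b ≢ d × b ≢ e × b ≢ f ×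
   c ≢ d × c ≢ e × c ≢ f × d ≢ e × d ≢ f × e ≢ f) ×
  edge H a b c ≡ true × edge H b c d ≡ true × edge H d e f ≡ true

Graph : ℕ → Set₁
Graph n = Fin n → Fin n → Set

IsVertexCover : ∀ {n} → Graph n → VSet n → Set
IsVertexCover G C = ∀ a b → G a b → C a ≡ true ⊎ C b ≡ true

VertexCoverNumber : ∀ {n} → Graph n → ℕ → Set
VertexCoverNumber G k =
  (∃[ C ] (IsVertexCover G C × countB C ≡ k)) ×
  (∀ C → IsVertexCover G C → k ≤ countB C)

Trace : ∀ {n} → Hypergraph n → VSet n → Fin n → Graph n
Trace H U v a b =
  U v ≡ true × U a ≡ true × U b ≡ true × edge H v a b ≡ true

IsStarCenter : ∀ {n} → Graph n → Fin n → Set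
IsStarCenter G y = ∀ a b → G a b → a ≡ y ⊎ b ≡ y

InZ : ∀ {n} → Hypergraph n → VSet n → Fin n → Set
InZ H U z = U z ≡ true × VertexCoverNumber (Trace H U z) 1

InY : ∀ {n} → Hypergraph n → VSet n → Fin n → Set
InY H U y = ∃[ z ] (InZ H U z × IsStarCenter (Trace H U z) y)

InX : ∀ {n} → Hypergraph n → VSet n → Fin n → Set
InX H U x = U x ≡ true × ¬ InY H U x × ¬ InZ H U x

IsPartialSTS : ∀ {n} → Hypergraph n → VSet n → (Fin n → Set) → Set
IsPartialSTS H U W = ∀ a b c d → a ≢ b →
  (U a ≡ true × U b ≡ true × U c ≡ true × W a × W b × W c × edge H a b c ≡ true) →
  (U a ≡ true × U b ≡ true × U d ≡ true × W a × W b × W d × edge H a b d ≡ true) →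
  c ≡ d

module Submission where

-- Let H' = H[U] be the 13-core of an M-free 3-graph H, and suppose two triples abc, abd
-- of H' share the pair ab while c ≠ d and c ∈ X ∪ Y.  We derive a contradiction.
--
-- Write G = Tr(c) and T = {a,b,d}.  Because H has no messy path, every edge of G meets T
-- (two triples pqu, pqw and a triple uxy with x, y ∉ {p,q,w} would form wpq, pqu, uxy).
-- The same principle bounds the degree of any vertex y₁ ∉ T having a G-neighbour x that
-- has two further G-neighbours: y₁ would have degree ≤ 6 < 13.  Hence, for x ∈ T, either
-- G is a star centred at x, or x has at most five G-neighbours (d at most four).
--   * If G is a star centred at a (or b), then τ(G) = 1, so c ∈ Z and c ∉ X; and c ∉ Y,
--     since a vertex z ∈ Z whose trace is a star at c has degree ≤ 1 unless z = a, while
--     Tr(a) contains the edge bd avoiding c.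
--   * Otherwise all edges of G are covered by at most 5 + 4 + 2 pairs, so deg(c) ≤ 11.

open import Defs
open import Data.Nat using (ℕ; zero; suc; _+_; _≤_; _<ᵇ_; z≤n; s≤s)
open import Data.Nat.Properties
  using (≤-trans; ≤-reflexive; ≤-antisym; +-mono-≤; <ᵇ⇒<; <⇒≱; m≤m+n; m≤n+m; n<1⇒n≡0; ≰⇒>;
         _≤?_; +-identityʳ; +-commutativeSemigroup)
open import Data.Fin using (Fin; zero; suc; toℕ; _≟_; _<_)
open import Data.Fin.Properties using (any?; 0≢1+n; suc-injective; <-asym)
open import Data.Bool using (Bool; true; false; _∧_; if_then_else_)
open import Data.Bool.Properties using (¬-not; T-≡)
import Data.Bool.Properties as Bool
open import Data.Product using (_×_; _,_; proj₁; proj₂; ∃; ∃₂)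
open import Data.Product.Properties using (,-injectiveˡ; ,-injectiveʳ; ≡-dec)
open import Data.Sum using (_⊎_; inj₁; inj₂; [_,_]′)
import Data.Sum as Sum
open import Data.Empty using (⊥; ⊥-elim)
open import Data.List using (List; []; _∷_; _++_; length; map)
open import Data.List.Properties using (length-++; length-map)
open import Data.List.Relation.Unary.Any using (here; there)
open import Data.List.Membership.Propositional using (_∈_; _∉_)
open import Data.List.Membership.Propositional.Properties using (∈-map⁺; ∈-++⁺ˡ; ∈-++⁺ʳ)
open import Function using (_∘_; id; Equivalence)
open import Relation.Nullary using (¬_; Dec; yes; no; does)
open import Relation.Nullary.Decidable using (dec-true; decidable-stable; _×-dec_; _⊎-dec_; ¬?)
open import Relation.Unary using (Decidable)
open import Relation.Binary.PropositionalEquality using (_≡_; _≢_; refl; sym; trans; cong; cong₂; ≢-sym; module ≡-Reasoning)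
open import Algebra.Properties.CommutativeSemigroup +-commutativeSemigroup using (interchange)

does-true : ∀ {P : Set} (d : Dec P) → does d ≡ true → P
does-true (yes p) _ = p
does-true (no _) ()

∧-true : ∀ {x y : Bool} → x ∧ y ≡ true → x ≡ true × y ≡ true
∧-true {true} {true} _ = refl , refl

∧-split : ∀ {P : Set} {x : Bool} (d : Dec P) → x ≡ true → x ∧ does d ≡ true ⊎ x ∧ does (¬? d) ≡ true
∧-split (yes _) refl = inj₁ refl
∧-split (no _)  refl = inj₂ refl

indicator : Bool → ℕ
indicator b = if b then 1 else 0

indicator-∨ : ∀ {x y z : Bool} → (x ≡ true → y ≡ true ⊎ z ≡ true) →
  indicator x ≤ indicator y + indicator z
indicator-∨ {false}                 _ = z≤n
indicator-∨ {true}  {true}          _ = s≤s z≤n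
indicator-∨ {true}  {false} {true}  _ = s≤s z≤n
indicator-∨ {true}  {false} {false} k = [ (λ ()) , (λ ()) ]′ (k refl)

countB-none : ∀ {n} (f : Fin n → Bool) → (∀ i → f i ≡ false) → countB f ≡ 0
countB-none {zero}  f none = refl
countB-none {suc n} f none rewrite none zero = countB-none (f ∘ suc) (none ∘ suc)

countB-some : ∀ {n} (f : Fin n → Bool) i → f i ≡ true → 1 ≤ countB f
countB-some f zero fi rewrite fi = s≤s z≤n
countB-some f (suc i) fi =
  ≤-trans (countB-some (f ∘ suc) i fi) (m≤n+m _ (indicator (f zero)))

countB-witness : ∀ {n} (f : Fin n → Bool) → 1 ≤ countB f → ∃ λ i → f i ≡ true
countB-witness {suc n} f pos with f zero in f0
... | true  = zero , f0
... | false = let (i , fi) = countB-witness (f ∘ suc) pos in suc i , fi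

countB-atMostOne : ∀ {n} (f : Fin n → Bool) →
  (∀ i j → f i ≡ true → f j ≡ true → i ≡ j) → countB f ≤ 1
countB-atMostOne {zero}  f unique = z≤n
countB-atMostOne {suc n} f unique with f zero in f0
... | true  = ≤-reflexive (cong suc (countB-none (f ∘ suc) rest))
  where
  rest : ∀ i → f (suc i) ≡ false
  rest i = ¬-not (λ fi → 0≢1+n (unique zero (suc i) f0 fi))
... | false = countB-atMostOne (f ∘ suc) (λ i j fi fj → suc-injective (unique _ _ fi fj))

countB-∨ : ∀ {n} (f g h : Fin n → Bool) → (∀ i → f i ≡ true → g i ≡ true ⊎ h i ≡ true) →
  countB f ≤ countB g + countB h
countB-∨ {zero}  f g h split = z≤n
countB-∨ {suc n} f g h split =
  ≤-trans (+-mono-≤ (indicator-∨ (split zero)) (countB-∨ (f ∘ suc) (g ∘ suc) (h ∘ suc) (split ∘ suc)))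
          (≤-reflexive (interchange (indicator (g zero)) (indicator (h zero)) _ _))

sumF-none : ∀ {n} (f : Fin n → ℕ) → (∀ i → f i ≡ 0) → sumF f ≡ 0
sumF-none {zero}  f none = refl
sumF-none {suc n} f none rewrite none zero = sumF-none (f ∘ suc) (none ∘ suc)

sumF-mono : ∀ {n} (f g : Fin n → ℕ) → (∀ i → f i ≤ g i) → sumF f ≤ sumF g
sumF-mono {zero}  f g le = z≤n
sumF-mono {suc n} f g le = +-mono-≤ (le zero) (sumF-mono (f ∘ suc) (g ∘ suc) (le ∘ suc))

sumF-+ : ∀ {n} (f g : Fin n → ℕ) → sumF (λ i → f i + g i) ≡ sumF f + sumF g
sumF-+ {zero}  f g = refl
sumF-+ {suc n} f g =
  trans (cong (f zero + g zero +_) (sumF-+ (f ∘ suc) (g ∘ suc))) (interchange (f zero) (g zero) _ _)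

sumF-atMostOne : ∀ {n} (f : Fin n → ℕ) → (∀ i → f i ≤ 1) →
  (∀ i j → 1 ≤ f i → 1 ≤ f j → i ≡ j) → sumF f ≤ 1
sumF-atMostOne {zero}  f bounded unique = z≤n
sumF-atMostOne {suc n} f bounded unique with 1 ≤? f zero
... | yes pos =
  ≤-trans (≤-reflexive (trans (cong (f zero +_) (sumF-none (f ∘ suc) rest)) (+-identityʳ (f zero))))
          (bounded zero)
  where
  rest : ∀ i → f (suc i) ≡ 0
  rest i with 1 ≤? f (suc i)
  ... | yes posᵢ = ⊥-elim (0≢1+n (unique zero (suc i) pos posᵢ))
  ... | no ¬posᵢ = n<1⇒n≡0 (≰⇒> ¬posᵢ)
... | no ¬pos rewrite n<1⇒n≡0 (≰⇒> ¬pos) =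
  sumF-atMostOne (f ∘ suc) (bounded ∘ suc) (λ i j pi pj → suc-injective (unique _ _ pi pj))

-- Counting ordered pairs: deg H U v is definitionally such a count.

pairCount : ∀ {n} → (Fin n → Fin n → Bool) → ℕ
pairCount f = sumF (λ p → countB (f p))

pairCount-none : ∀ {n} (f : Fin n → Fin n → Bool) → (∀ p q → f p q ≡ false) → pairCount f ≡ 0
pairCount-none f none = sumF-none _ (λ p → countB-none (f p) (none p))

pairCount-∨ : ∀ {n} (f g h : Fin n → Fin n → Bool) →
  (∀ p q → f p q ≡ true → g p q ≡ true ⊎ h p q ≡ true) →
  pairCount f ≤ pairCount g + pairCount h
pairCount-∨ f g h split =
  ≤-trans (sumF-mono _ _ (λ p → countB-∨ (f p) (g p) (h p) (split p)))
          (≤-reflexive (sumF-+ (countB ∘ g) (countB ∘ h)))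

pairCount-atMostOne : ∀ {n} (f : Fin n → Fin n → Bool) →
  (∀ {p q p′ q′} → f p q ≡ true → f p′ q′ ≡ true → (p , q) ≡ (p′ , q′)) → pairCount f ≤ 1
pairCount-atMostOne f unique =
  sumF-atMostOne _ (λ p → countB-atMostOne (f p) (λ q q′ e e′ → ,-injectiveʳ (unique e e′)))
    (λ p p′ pos pos′ →
      let (q , e) = countB-witness (f p) pos ; (q′ , e′) = countB-witness (f p′) pos′
      in ,-injectiveˡ (unique e e′))

Matches : ∀ {n} → Fin n × Fin n → Fin n → Fin n → Set
Matches e p q = (p , q) ≡ e ⊎ (q , p) ≡ e

Covered : ∀ {n} → List (Fin n × Fin n) → Fin n → Fin n → Set
Covered L p q = (p , q) ∈ L ⊎ (q , p) ∈ L

Covered-swap : ∀ {n} {L : List (Fin n × Fin n)} {p q} → Covered L p q → Covered L q p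
Covered-swap = [ inj₂ , inj₁ ]′

Covered-∷ : ∀ {n} {e : Fin n × Fin n} {L p q} → Covered (e ∷ L) p q → Matches e p q ⊎ Covered L p q
Covered-∷ (inj₁ (here eq))  = inj₁ (inj₁ eq)
Covered-∷ (inj₁ (there m))  = inj₂ (inj₁ m)
Covered-∷ (inj₂ (here eq))  = inj₁ (inj₂ eq)
Covered-∷ (inj₂ (there m))  = inj₂ (inj₂ m)

Matches-increasing : ∀ {n} {e : Fin n × Fin n} {p q p′ q′} → p < q → p′ < q′ →
  Matches e p q → Matches e p′ q′ → (p , q) ≡ (p′ , q′)
Matches-increasing _  _   (inj₁ refl) (inj₁ refl) = refl
Matches-increasing _  _   (inj₂ refl) (inj₂ refl) = refl
Matches-increasing lt lt′ (inj₁ refl) (inj₂ refl) = ⊥-elim (<-asym lt lt′)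
Matches-increasing lt lt′ (inj₂ refl) (inj₁ refl) = ⊥-elim (<-asym lt lt′)

pairCount-cover : ∀ {n} (f : Fin n → Fin n → Bool) (L : List (Fin n × Fin n)) →
  (∀ p q → f p q ≡ true → p < q × Covered L p q) → pairCount f ≤ length L
pairCount-cover f [] cover =
  ≤-reflexive (pairCount-none f (λ p q → ¬-not (λ fpq → [ (λ ()) , (λ ()) ]′ (proj₂ (cover p q fpq)))))
pairCount-cover {n} f (e ∷ L) cover =
  ≤-trans (pairCount-∨ f atHead inTail split)
          (+-mono-≤ (pairCount-atMostOne atHead unique) (pairCount-cover inTail L tailCover))
  where
  matches? : ∀ p q → Dec (Matches e p q)
  matches? p q = ≡-dec _≟_ _≟_ (p , q) e ⊎-dec ≡-dec _≟_ _≟_ (q , p) e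

  atHead inTail : Fin n → Fin n → Bool
  atHead p q = f p q ∧ does (matches? p q)
  inTail p q = f p q ∧ does (¬? (matches? p q))

  split : ∀ p q → f p q ≡ true → atHead p q ≡ true ⊎ inTail p q ≡ true
  split p q = ∧-split (matches? p q)

  unique : ∀ {p q p′ q′} → atHead p q ≡ true → atHead p′ q′ ≡ true → (p , q) ≡ (p′ , q′)
  unique {p} {q} {p′} {q′} h h′ =
    let (fpq , m) = ∧-true h ; (fpq′ , m′) = ∧-true h′
    in Matches-increasing (proj₁ (cover p q fpq)) (proj₁ (cover p′ q′ fpq′))
         (does-true (matches? p q) m) (does-true (matches? p′ q′) m′)

  tailCover : ∀ p q → inTail p q ≡ true → p < q × Covered L p q
  tailCover p q h with ∧-true {f p q} h
  ... | fpq , nm with cover p q fpq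
  ...   | lt , c = lt , [ (λ m → ⊥-elim (does-true (¬? (matches? p q)) nm m)) , id ]′ (Covered-∷ c)

∈-third : ∀ {n} {z u v w : Fin n} → z ∈ u ∷ v ∷ w ∷ [] → z ≢ u → z ≢ v → z ≡ w
∈-third (here z≡u)                 z≢u _   = ⊥-elim (z≢u z≡u)
∈-third (there (here z≡v))         _   z≢v = ⊥-elim (z≢v z≡v)
∈-third (there (there (here z≡w))) _   _   = z≡w

containsBoth : ∀ {n} {p q y₂ y₃ : Fin n} → y₂ ≢ y₃ →
  p ≡ y₂ ⊎ q ≡ y₂ → p ≡ y₃ ⊎ q ≡ y₃ → Matches (y₂ , y₃) p q
containsBoth y₂≢y₃ (inj₁ refl) (inj₁ p≡y₃) = ⊥-elim (y₂≢y₃ p≡y₃)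
containsBoth y₂≢y₃ (inj₁ refl) (inj₂ refl) = inj₁ refl
containsBoth y₂≢y₃ (inj₂ refl) (inj₁ refl) = inj₂ refl
containsBoth y₂≢y₃ (inj₂ refl) (inj₂ q≡y₃) = ⊥-elim (y₂≢y₃ q≡y₃)

-- A decidable predicate either has three distinct witnesses, or all its witnesses lie among
-- two points (y₀ serves as a default point when there are none).
threeOrTwo : ∀ {n} (P : Fin n → Set) → Decidable P → Fin n →
  (∃₂ λ y₁ y₂ → ∃ λ y₃ → P y₁ × P y₂ × P y₃ × y₁ ≢ y₂ × y₁ ≢ y₃ × y₂ ≢ y₃) ⊎
  (∃₂ λ y₁ y₂ → ∀ y → P y → y ∈ y₁ ∷ y₂ ∷ [])
threeOrTwo P P? y₀ with any? P?
... | no none = inj₂ (y₀ , y₀ , λ y py → ⊥-elim (none (y , py)))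
... | yes (y₁ , p₁) with any? (λ y → P? y ×-dec ¬? (y ≟ y₁))
...   | no none = inj₂ (y₁ , y₁ , λ y py → here (decidable-stable (y ≟ y₁) (λ ne → none (y , py , ne))))
...   | yes (y₂ , p₂ , y₂≢y₁) with any? (λ y → P? y ×-dec (¬? (y ≟ y₁) ×-dec ¬? (y ≟ y₂)))
...     | yes (y₃ , p₃ , y₃≢y₁ , y₃≢y₂) =
          inj₁ (y₁ , y₂ , y₃ , p₁ , p₂ , p₃ , ≢-sym y₂≢y₁ , ≢-sym y₃≢y₁ , ≢-sym y₃≢y₂)
...     | no none = inj₂ (y₁ , y₂ , among)
  where
  among : ∀ y → P y → y ∈ y₁ ∷ y₂ ∷ []
  among y py with y ≟ y₁
  ... | yes y≡y₁ = here y≡y₁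
  ... | no  y≢y₁ = there (here (decidable-stable (y ≟ y₂) (λ y≢y₂ → none (y , py , y≢y₁ , y≢y₂))))

starOrAvoidingEdge : ∀ {n} (G : Graph n) → (∀ p q → Dec (G p q)) → ∀ x →
  IsStarCenter G x ⊎ (∃₂ λ s t → G s t × s ≢ x × t ≢ x)
starOrAvoidingEdge G G? x with any? (λ s → any? (λ t → G? s t ×-dec (¬? (s ≟ x) ×-dec ¬? (t ≟ x))))
... | yes (s , t , avoiding) = inj₂ (s , t , avoiding)
... | no none = inj₁ star
  where
  star : IsStarCenter G x
  star s t g with s ≟ x | t ≟ x
  ... | yes s≡x | _        = inj₁ s≡x
  ... | no _    | yes t≡x  = inj₂ t≡x
  ... | no s≢x  | no t≢x   = ⊥-elim (none (s , t , g , s≢x , t≢x))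

-- A nonempty star has vertex cover number 1: its centre covers it, and any cover
-- contains an endpoint of the edge xo.
star⇒coverNumber1 : ∀ {n} (G : Graph n) {x o} → G x o → IsStarCenter G x → VertexCoverNumber G 1
star⇒coverNumber1 G {x} {o} xo star = (isX , covers , countIsX) , minimal
  where
  isX : VSet _
  isX v = does (v ≟ x)

  covers : IsVertexCover G isX
  covers p q g = [ inj₁ ∘ dec-true (p ≟ x) , inj₂ ∘ dec-true (q ≟ x) ]′ (star p q g)

  countIsX : countB isX ≡ 1
  countIsX = ≤-antisym
    (countB-atMostOne isX (λ i j ei ej → trans (does-true (i ≟ x) ei) (sym (does-true (j ≟ x) ej))))
    (countB-some isX x (dec-true (x ≟ x) refl))

  minimal : ∀ C → IsVertexCover G C → 1 ≤ countB C
  minimal C cover = [ countB-some C x , countB-some C o ]′ (cover x o xo)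

module Hypergraphs {n : ℕ} (H : Hypergraph n) where

  open import Data.List.Membership.DecPropositional (_≟_ {n}) using (_∈?_)

  edge-swap₁₂ : ∀ {p q r} → edge H p q r ≡ true → edge H q p r ≡ true
  edge-swap₁₂ {p} {q} {r} e = trans (sym (sym₁ H p q r)) e

  edge-swap₂₃ : ∀ {p q r} → edge H p q r ≡ true → edge H p r q ≡ true
  edge-swap₂₃ {p} {q} {r} e = trans (sym (sym₂ H p q r)) e

  -- Forbidding the messy path: given triples pqu and pqw with u ≠ w, every triple uxy meets
  -- {p,q,w}, for otherwise wpq, pqu, uxy would be a copy of M.
  messyFree : ¬ ContainsM H → ∀ {p q u w x y} →
    edge H p q u ≡ true → edge H p q w ≡ true → u ≢ w → edge H u x y ≡ true →
    x ∈ p ∷ q ∷ w ∷ [] ⊎ y ∈ p ∷ q ∷ w ∷ []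
  messyFree noM {p} {q} {u} {w} {x} {y} pqu pqw u≢w uxy
    with x ∈? p ∷ q ∷ w ∷ [] | y ∈? p ∷ q ∷ w ∷ []
  ... | yes x∈ | _      = inj₁ x∈
  ... | no _   | yes y∈ = inj₂ y∈
  ... | no x∉  | no y∉  =
    let (p≢q , q≢u , p≢u) = distinct H p q u pqu
        (_   , q≢w , p≢w) = distinct H p q w pqw
        (u≢x , x≢y , u≢y) = distinct H u x y uxy
    in ⊥-elim (noM (w , p , q , u , x , y ,
            (≢-sym p≢w , ≢-sym q≢w , ≢-sym u≢w , (x∉ ∘ there ∘ there ∘ here ∘ sym) ,
             (y∉ ∘ there ∘ there ∘ here ∘ sym) , p≢q , p≢u , (x∉ ∘ here ∘ sym) , (y∉ ∘ here ∘ sym) ,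
             q≢u , (x∉ ∘ there ∘ here ∘ sym) , (y∉ ∘ there ∘ here ∘ sym) , u≢x , u≢y , x≢y) ,
            edge-swap₁₂ (edge-swap₂₃ pqw) , pqu , uxy))

  module Traces (U : VSet n) where

    Tr : Fin n → Graph n
    Tr = Trace H U

    trace-edge : ∀ {v p q} → Tr v p q → edge H v p q ≡ true
    trace-edge (_ , _ , _ , e) = e

    trace-swap : ∀ {v p q} → Tr v p q → Tr v q p
    trace-swap (uv , up , uq , e) = uv , uq , up , edge-swap₂₃ e

    trace-rotate : ∀ {v p q} → Tr v p q → Tr p v q
    trace-rotate (uv , up , uq , e) = up , uv , uq , edge-swap₁₂ e

    trace? : ∀ v p q → Dec (Tr v p q)
    trace? v p q = (U v Bool.≟ true) ×-dec (U p Bool.≟ true) ×-dec (U q Bool.≟ true) ×-dec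
                   (edge H v p q Bool.≟ true)

    degree-cover : ∀ v (L : List (Fin n × Fin n)) → (∀ {p q} → Tr v p q → Covered L p q) →
      deg H U v ≤ length L
    degree-cover v L cover = pairCount-cover _ L counted
      where
      counted : ∀ p q → ((toℕ p <ᵇ toℕ q) ∧ U v ∧ U p ∧ U q ∧ edge H v p q) ≡ true →
        p < q × Covered L p q
      counted p q h =
        let (lt , h₁) = ∧-true {toℕ p <ᵇ toℕ q} h ; (uv , h₂) = ∧-true {U v} h₁
            (up , h₃) = ∧-true {U p} h₂ ; (uq , e) = ∧-true {U q} h₃
        in <ᵇ⇒< (toℕ p) (toℕ q) (Equivalence.from T-≡ lt) , cover (uv , up , uq , e)

    module Core (noM : ¬ ContainsM H) (core : ∀ v → U v ≡ true → 13 ≤ deg H U v) where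

      lowDegree : ∀ {v} → U v ≡ true → deg H U v ≤ 12 → ⊥
      lowDegree {v} uv deg≤12 = <⇒≱ (s≤s deg≤12) (core v uv)

      -- If Tr(c) is a nonempty star centred at x and Tr(x) has an edge pq avoiding c, then
      -- c ∈ Z, and c ∉ Y: a vertex z ∈ Z whose trace is a star centred at c is either x,
      -- impossible by pq, or has all its trace edges equal to cx, so degree ≤ 1.
      starTrace⇒¬XY : ∀ {c x o p q} → IsStarCenter (Tr c) x → Tr c x o → Tr x p q → p ≢ c → q ≢ c →
        ¬ (InX H U c ⊎ InY H U c)
      starTrace⇒¬XY {c} {x} {_} {p} {q} star cxo xpq p≢c q≢c = [ notX , notY ]′
        where
        c∈Z : InZ H U c
        c∈Z = proj₁ cxo , star⇒coverNumber1 (Tr c) cxo star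

        notX : ¬ InX H U c
        notX (_ , _ , c∉Z) = c∉Z c∈Z

        notY : ¬ InY H U c
        notY (z , (uz , _) , starZ) with z ≟ x
        ... | yes refl = [ p≢c , q≢c ]′ (starZ p q xpq)
        ... | no z≢x   = lowDegree uz (≤-trans (degree-cover z ((c , x) ∷ []) cover) (s≤s z≤n))
          where
          throughC : ∀ {r} → Tr z c r → r ≡ x
          throughC zcr = [ (λ z≡x → ⊥-elim (z≢x z≡x)) , id ]′ (star _ _ (trace-rotate zcr))

          cover : ∀ {r s} → Tr z r s → Covered ((c , x) ∷ []) r s
          cover zrs with starZ _ _ zrs
          ... | inj₁ refl = inj₁ (here (cong (c ,_) (throughC zrs)))
          ... | inj₂ refl = inj₂ (here (cong (c ,_) (throughC (trace-swap zrs))))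

      module TwoTriples {a b c d : Fin n} (abc : Tr a b c) (abd : Tr a b d) (c≢d : c ≢ d) where

        G : Graph n
        G = Tr c

        T : List (Fin n)
        T = a ∷ b ∷ d ∷ []

        cab : G a b
        cab = trace-rotate (trace-swap abc)

        a≢c : a ≢ c
        a≢c = proj₂ (proj₂ (distinct H a b c (trace-edge abc)))

        b≢c : b ≢ c
        b≢c = proj₁ (proj₂ (distinct H a b c (trace-edge abc)))

        a≢d : a ≢ d
        a≢d = proj₂ (proj₂ (distinct H a b d (trace-edge abd)))

        b≢d : b ≢ d
        b≢d = proj₁ (proj₂ (distinct H a b d (trace-edge abd)))

        othersOfA : ∀ {z} → z ∈ T → z ≢ a → z ∈ b ∷ d ∷ []
        othersOfA (here z≡a) z≢a = ⊥-elim (z≢a z≡a)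
        othersOfA (there z∈bd) _ = z∈bd

        othersOfB : ∀ {z} → z ∈ T → z ≢ b → z ∈ a ∷ d ∷ []
        othersOfB (here z≡a)                 _   = here z≡a
        othersOfB (there (here z≡b))         z≢b = ⊥-elim (z≢b z≡b)
        othersOfB (there (there (here z≡d))) _   = there (here z≡d)

        othersOfD : ∀ {z} → z ∈ T → z ≢ d → z ∈ a ∷ b ∷ []
        othersOfD (here z≡a)                 _   = here z≡a
        othersOfD (there (here z≡b))         _   = there (here z≡b)
        othersOfD (there (there (here z≡d))) z≢d = ⊥-elim (z≢d z≡d)

        meetsT : ∀ {p q} → G p q → p ∈ T ⊎ q ∈ T
        meetsT cpq = messyFree noM (trace-edge abc) (trace-edge abd) c≢d (trace-edge cpq)

        -- A G-neighbour y₁ ∉ T of x, where x has two further G-neighbours y₂ y₃ and G has an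
        -- edge st avoiding x and y₁, would have degree at most 6: its trace edges are covered by
        -- ca, cb, cd (through c), xs, xt (through x) and y₂y₃ (avoiding c and x).
        leafLowDegree : ∀ {x s t y₁ y₂ y₃} → G s t → x ≢ s → x ≢ t → y₁ ≢ s → y₁ ≢ t → y₁ ∉ T →
          G x y₁ → G x y₂ → G x y₃ → y₁ ≢ y₂ → y₁ ≢ y₃ → y₂ ≢ y₃ → ⊥
        leafLowDegree {x} {s} {t} {y₁} {y₂} {y₃}
                      cst x≢s x≢t y₁≢s y₁≢t y₁∉T cxy₁ cxy₂ cxy₃ y₁≢y₂ y₁≢y₃ y₂≢y₃ =
          lowDegree (proj₁ (proj₂ (proj₂ cxy₁))) (≤-trans (degree-cover y₁ L cover) (m≤m+n 6 6))
          where
          L : List (Fin n × Fin n)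
          L = map (c ,_) T ++ map (x ,_) (s ∷ t ∷ []) ++ (y₂ , y₃) ∷ []

          throughC : ∀ {q} → Tr y₁ c q → q ∈ T
          throughC y₁cq = [ (λ y₁∈T → ⊥-elim (y₁∉T y₁∈T)) , id ]′ (meetsT (trace-rotate y₁cq))

          -- messyFree on xy₁c, xy₁q, cst
          throughX : ∀ {q} → Tr y₁ x q → q ≢ c → q ∈ s ∷ t ∷ []
          throughX y₁xq q≢c =
            [ (λ s∈ → here (sym (∈-third s∈ (≢-sym x≢s) (≢-sym y₁≢s))))
            , (λ t∈ → there (here (sym (∈-third t∈ (≢-sym x≢t) (≢-sym y₁≢t))))) ]′
            (messyFree noM (edge-swap₂₃ (edge-swap₁₂ (trace-edge cxy₁))) (edge-swap₁₂ (trace-edge y₁xq))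
                       (≢-sym q≢c) (trace-edge cst))

          -- messyFree on cxy₁, cxw, y₁pq for w = y₂ and w = y₃
          avoiding : ∀ {p q} → Tr y₁ p q → p ≢ c → q ≢ c → p ≢ x → q ≢ x → Matches (y₂ , y₃) p q
          avoiding {p} {q} y₁pq p≢c q≢c p≢x q≢x = containsBoth y₂≢y₃ (hits cxy₂ y₁≢y₂) (hits cxy₃ y₁≢y₃)
            where
            hits : ∀ {w} → G x w → y₁ ≢ w → p ≡ w ⊎ q ≡ w
            hits cxw y₁≢w =
              Sum.map (λ m → ∈-third m p≢c p≢x) (λ m → ∈-third m q≢c q≢x)
                (messyFree noM (trace-edge cxy₁) (trace-edge cxw) y₁≢w (trace-edge y₁pq))

          viaC : ∀ {q} → q ∈ T → (c , q) ∈ L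
          viaC m = ∈-++⁺ˡ (∈-map⁺ (c ,_) m)

          viaX : ∀ {q} → q ∈ s ∷ t ∷ [] → (x , q) ∈ L
          viaX m = ∈-++⁺ʳ (map (c ,_) T) (∈-++⁺ˡ (∈-map⁺ (x ,_) m))

          viaY : ∀ {e} → e ≡ (y₂ , y₃) → e ∈ L
          viaY e = ∈-++⁺ʳ (map (c ,_) T) (∈-++⁺ʳ (map (x ,_) (s ∷ t ∷ [])) (here e))

          cover : ∀ {p q} → Tr y₁ p q → Covered L p q
          cover {p} {q} y₁pq with p ≟ c | q ≟ c
          ... | yes refl | _        = inj₁ (viaC (throughC y₁pq))
          ... | no _     | yes refl = inj₂ (viaC (throughC (trace-swap y₁pq)))
          ... | no p≢c   | no q≢c   with p ≟ x | q ≟ x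
          ...   | yes refl | _        = inj₁ (viaX (throughX y₁pq q≢c))
          ...   | no _     | yes refl = inj₂ (viaX (throughX (trace-swap y₁pq) p≢c))
          ...   | no p≢x   | no q≢x   = [ inj₁ ∘ viaY , inj₂ ∘ viaY ]′ (avoiding y₁pq p≢c q≢c p≢x q≢x)

        neighbourhoodBound : ∀ {x s t} (E : List (Fin n)) → G s t → x ≢ s → x ≢ t → s ∈ E → t ∈ E →
          (∀ {z} → z ∈ T → z ≢ x → z ∈ E) → ∃₂ λ y₁ y₂ → ∀ {y} → G x y → y ∈ E ++ y₁ ∷ y₂ ∷ []
        neighbourhoodBound {x} E cst x≢s x≢t s∈E t∈E T⊆E
          with threeOrTwo (λ y → G x y × y ∉ E) (λ y → trace? c x y ×-dec ¬? (y ∈? E)) x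
        ... | inj₁ (y₁ , y₂ , y₃ , (cxy₁ , y₁∉E) , (cxy₂ , _) , (cxy₃ , _) , y₁≢y₂ , y₁≢y₃ , y₂≢y₃) =
          ⊥-elim (leafLowDegree cst x≢s x≢t (outside s∈E) (outside t∈E) y₁∉T cxy₁ cxy₂ cxy₃
                                y₁≢y₂ y₁≢y₃ y₂≢y₃)
          where
          outside : ∀ {z} → z ∈ E → y₁ ≢ z
          outside z∈E refl = y₁∉E z∈E

          y₁∉T : y₁ ∉ T
          y₁∉T y₁∈T = y₁∉E (T⊆E y₁∈T (≢-sym (proj₁ (proj₂ (distinct H c x y₁ (trace-edge cxy₁))))))
        ... | inj₂ (y₁ , y₂ , few) = y₁ , y₂ , bound
          where
          bound : ∀ {y} → G x y → y ∈ E ++ y₁ ∷ y₂ ∷ []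
          bound {y} cxy with y ∈? E
          ... | yes y∈E = ∈-++⁺ˡ y∈E
          ... | no  y∉E = ∈-++⁺ʳ E (few y (cxy , y∉E))

        -- If a G-edge st avoids x ∈ T, then x has at most five G-neighbours, two of them being
        -- the other vertices o₁ o₂ of T: orient st as wt′ with w ∈ T (by meetsT) and apply
        -- neighbourhoodBound with E = o₁ o₂ t′.
        fiveNeighbours : ∀ {x o₁ o₂ s t} → (∀ {z} → z ∈ T → z ≢ x → z ∈ o₁ ∷ o₂ ∷ []) →
          G s t → s ≢ x → t ≢ x →
          ∃ λ t′ → ∃₂ λ y₁ y₂ → ∀ {y} → G x y → y ∈ o₁ ∷ o₂ ∷ t′ ∷ y₁ ∷ y₂ ∷ []
        fiveNeighbours {x} {o₁} {o₂} others cst s≢x t≢x =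
          [ (λ s∈T → oriented (others s∈T s≢x) cst s≢x t≢x)
          , (λ t∈T → oriented (others t∈T t≢x) (trace-swap cst) t≢x s≢x) ]′ (meetsT cst)
          where
          oriented : ∀ {w t′} → w ∈ o₁ ∷ o₂ ∷ [] → G w t′ → w ≢ x → t′ ≢ x →
            ∃ λ t″ → ∃₂ λ y₁ y₂ → ∀ {y} → G x y → y ∈ o₁ ∷ o₂ ∷ t″ ∷ y₁ ∷ y₂ ∷ []
          oriented {_} {t′} w∈O cwt′ w≢x t′≢x =
            let (y₁ , y₂ , bound) =
                  neighbourhoodBound (o₁ ∷ o₂ ∷ t′ ∷ []) cwt′ (≢-sym w≢x) (≢-sym t′≢x)
                    (∈-++⁺ˡ w∈O) (there (there (here refl))) (λ z∈T z≢x → ∈-++⁺ˡ (others z∈T z≢x))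
            in t′ , y₁ , y₂ , bound

        -- If every G-neighbour of a lies in Nᵃ, those of b in a ∷ Nᵇ and those of d in a ∷ b ∷ Nᵈ,
        -- then the pairs from a to Nᵃ, from b to Nᵇ and from d to Nᵈ cover G (as every edge
        -- meets T), so deg(c) ≤ |Nᵃ| + |Nᵇ| + |Nᵈ|.
        coverByNeighbourhoods : ∀ (Nᵃ Nᵇ Nᵈ : List (Fin n)) →
          (∀ {y} → G a y → y ∈ Nᵃ) → (∀ {y} → G b y → y ∈ a ∷ Nᵇ) → (∀ {y} → G d y → y ∈ a ∷ b ∷ Nᵈ) →
          deg H U c ≤ length Nᵃ + (length Nᵇ + length Nᵈ)
        coverByNeighbourhoods Nᵃ Nᵇ Nᵈ inNᵃ inNᵇ inNᵈ =
          ≤-trans (degree-cover c L cover) (≤-reflexive lengthL)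
          where
          L : List (Fin n × Fin n)
          L = map (a ,_) Nᵃ ++ map (b ,_) Nᵇ ++ map (d ,_) Nᵈ

          lengthL : length L ≡ length Nᵃ + (length Nᵇ + length Nᵈ)
          lengthL = begin
            length L
              ≡⟨ length-++ (map (a ,_) Nᵃ) ⟩
            length (map (a ,_) Nᵃ) + length (map (b ,_) Nᵇ ++ map (d ,_) Nᵈ)
              ≡⟨ cong (length (map (a ,_) Nᵃ) +_) (length-++ (map (b ,_) Nᵇ)) ⟩
            length (map (a ,_) Nᵃ) + (length (map (b ,_) Nᵇ) + length (map (d ,_) Nᵈ))
              ≡⟨ cong₂ _+_ (length-map (a ,_) Nᵃ)
                           (cong₂ _+_ (length-map (b ,_) Nᵇ) (length-map (d ,_) Nᵈ)) ⟩
            length Nᵃ + (length Nᵇ + length Nᵈ) ∎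
            where open ≡-Reasoning

          coverA : ∀ {q} → G a q → Covered L a q
          coverA caq = inj₁ (∈-++⁺ˡ (∈-map⁺ (a ,_) (inNᵃ caq)))

          coverB : ∀ {q} → G b q → Covered L b q
          coverB cbq with inNᵇ cbq
          ... | here refl = Covered-swap (coverA (trace-swap cbq))
          ... | there q∈Nᵇ = inj₁ (∈-++⁺ʳ (map (a ,_) Nᵃ) (∈-++⁺ˡ (∈-map⁺ (b ,_) q∈Nᵇ)))

          coverD : ∀ {q} → G d q → Covered L d q
          coverD cdq with inNᵈ cdq
          ... | here refl         = Covered-swap (coverA (trace-swap cdq))
          ... | there (here refl) = Covered-swap (coverB (trace-swap cdq))
          ... | there (there q∈Nᵈ) =
            inj₁ (∈-++⁺ʳ (map (a ,_) Nᵃ) (∈-++⁺ʳ (map (b ,_) Nᵇ) (∈-map⁺ (d ,_) q∈Nᵈ)))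

          coverT : ∀ {p q} → p ∈ T → G p q → Covered L p q
          coverT (here refl)                 = coverA
          coverT (there (here refl))         = coverB
          coverT (there (there (here refl))) = coverD

          cover : ∀ {p q} → G p q → Covered L p q
          cover cpq = [ (λ p∈T → coverT p∈T cpq) , (λ q∈T → Covered-swap (coverT q∈T (trace-swap cpq))) ]′
                      (meetsT cpq)

        -- If G is a star centred at a or b, use starTrace⇒¬XY with the trace edge
        -- bd of a (resp. ad of b).  Otherwise a and b have at most five G-neighbours and d at
        -- most four, which gives deg(c) ≤ 5 + 4 + 2.
        ¬XY : ¬ (InX H U c ⊎ InY H U c)
        ¬XY c∈XY with starOrAvoidingEdge G (trace? c) a
        ... | inj₁ starA = starTrace⇒¬XY starA cab abd b≢c (≢-sym c≢d) c∈XY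
        ... | inj₂ (s , t , cst , s≢a , t≢a) with starOrAvoidingEdge G (trace? c) b
        ...   | inj₁ starB = starTrace⇒¬XY starB (trace-swap cab) (trace-rotate abd) a≢c (≢-sym c≢d) c∈XY
        ...   | inj₂ (s′ , t′ , cs′t′ , s′≢b , t′≢b) =
          let (tᵃ , yᵃ₁ , yᵃ₂ , inNᵃ) = fiveNeighbours othersOfA cst s≢a t≢a
              (tᵇ , yᵇ₁ , yᵇ₂ , inNᵇ) = fiveNeighbours othersOfB cs′t′ s′≢b t′≢b
              (yᵈ₁ , yᵈ₂ , inNᵈ) = neighbourhoodBound (a ∷ b ∷ []) cab (≢-sym a≢d) (≢-sym b≢d)
                                     (here refl) (there (here refl)) othersOfD
          in lowDegree (proj₁ cab)
               (≤-trans (coverByNeighbourhoods (b ∷ d ∷ tᵃ ∷ yᵃ₁ ∷ yᵃ₂ ∷ []) (d ∷ tᵇ ∷ yᵇ₁ ∷ yᵇ₂ ∷ [])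
                                               (yᵈ₁ ∷ yᵈ₂ ∷ []) inNᵃ inNᵇ inNᵈ)
                        (m≤m+n 11 1))

-- Two triples abc, abd of the 13-core sharing the pair ab with c ≠ d would force c ∉ X ∪ Y.
mainTheorem14 : ∀ {n : ℕ} (H : Hypergraph n) (U : VSet n) →
    ¬ ContainsM H → IsCore 13 H U →
    IsPartialSTS H U (λ v → InX H U v ⊎ InY H U v)
mainTheorem14 H U noM (_ , core) a b c d _ (ua , ub , uc , _ , _ , c∈XY , abc) (_ , _ , ud , _ , _ , _ , abd)
  with c ≟ d
... | yes c≡d = c≡d
... | no  c≢d = ⊥-elim (TwoTriples.¬XY (ua , ub , uc , abc) (ua , ub , ud , abd) c≢d c∈XY)
  where open Hypergraphs.Traces.Core H U noM core
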